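{- Let $\Psi$ be an $L_\mu$ sentence that is semantically modal, i.e. equivalent on all trees to some fixpoint-free formula. Then there exists (effectively computable from $\Psi$) a modal (fixpoint-free) formula $\Phi$, over the propositional variables $E_i,O_i,M$, that interprets $\Psi$: for every tree $\mathfrak{T}$, $\mathfrak{T}\models\Psi$ iff $\mathfrak{T}\times\Psi\models\Phi$.
   Context: Unimodal $L_\mu$ has syntax $\phi ::= P \mid \neg P \mid X \mid \phi\wedge\phi \mid \phi\vee\phi \mid \Diamond\phi \mid \Box\phi \mid \mu X.\phi \mid \nu X.\phi \mid \bot \mid \top$ (negation only on propositional variables); formulas are assumed guarded (every occurrence of a fixpoint variable lies in the scope of a modality within its binding formula $\phi_X$), and are evaluated with the standard semantics on rooted finitely-branching trees labelled by sets of propositional variables. A priority assignment for a sentence $\Psi$ maps its fixpoint variables to $\{m,\dots,q\}$, $m\in\{0,1\}$, $\mu$-variables odd and $\nu$-variables even; it is order-preserving if whenever $X$ is free in the binding formula of $Y$ then $\Omega(X)\ge\Omega(Y)$. Model-checking game: fix an order-preserving priority assignment $\Omega_\Psi$ of $\Psi$ with codomain $J$. For a tree $\mathfrak{T}$ with root $r$, $\mathfrak{T}\times\Psi$ has positions $(s,\phi)$ ($s$ a state, $\phi$ a subformula of $\Psi$); $(s,\phi\wedge\psi)$ and $(s,\Box\phi)$ belong to Odd, others to Even, except that $(s,C)$ for a literal $C$ is terminal and belongs to Odd if $C$ holds at $s$, to Even otherwise ($(s,\top)$ Odd's, $(s,\bot)$ Even's; a player unable to move loses). Edges: $(s,\phi\vee\psi),(s,\phi\wedge\psi)\to(s,\phi),(s,\psi)$;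 $(s,X),(s,\mu X.\phi_X),(s,\nu X.\phi_X)\to(s,\phi_X)$; $(s,\Diamond\phi),(s,\Box\phi)\to(s',\phi)$ for each successor $s'$ of $s$. Initial position $(r,\Psi)$. $(s,X)$ has priority $\Omega_\Psi(X)$, all other positions the minimal priority of $J$; Even wins an infinite play iff the highest priority seen infinitely often is even. The arena is encoded as a rooted labelled structure by labelling Even positions of priority $i$ with $E_i$, Odd positions of priority $i$ with $O_i$, and modal positions $(s,\Box\phi),(s,\Diamond\phi)$ with $M$; $\mathfrak{T}\times\Psi\models\Phi$ means $\Phi$ holds at the initial position. -}

module Defs where

open import Data.Nat using (ℕ; zero; suc; _≤_; _%_; _≡ᵇ_)
open import Data.Bool using (Bool; true; false; not; _∧_; if_then_else_; T)
open import Data.List using (List; []; _∷_; map)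
open import Data.List.Relation.Unary.Any using (Any)
open import Data.List.Relation.Unary.All using (All)
open import Data.Maybe using (Maybe; just; nothing)
open import Data.Product using (Σ; _×_; _,_)
open import Data.Sum using (_⊎_)
open import Data.Empty using (⊥)
open import Data.Unit using (⊤)
open import Relation.Binary.PropositionalEquality using (_≡_; _≢_)
open import Relation.Nullary using (¬_)
open import Function.Bundles using (_⇔_)

Var : Set
Var = ℕ

data Formula (P : Set) : Set where
  prop  : P → Formula P
  nprop : P → Formula P
  var   : Var → Formula P
  _∧ᶠ_  : Formula P → Formula P → Formula P
  _∨ᶠ_  : Formula P → Formula P → Formula P
  dia   : Formula P → Formula P
  box   : Formula P → Formula P
  mu    : Var → Formula P → Formula P
  nu    : Var → Formula P → Formula P
  bot   : Formula P
  top   : Formula P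

module _ {P : Set} where

  FixFree : Formula P → Set
  FixFree (prop _)  = ⊤
  FixFree (nprop _) = ⊤
  FixFree (var _)   = ⊥
  FixFree (φ ∧ᶠ ψ)  = FixFree φ × FixFree ψ
  FixFree (φ ∨ᶠ ψ)  = FixFree φ × FixFree ψ
  FixFree (dia φ)   = FixFree φ
  FixFree (box φ)   = FixFree φ
  FixFree (mu _ _)  = ⊥
  FixFree (nu _ _)  = ⊥
  FixFree bot       = ⊤
  FixFree top       = ⊤

  data _≼_ : Formula P → Formula P → Set where
    ≼-refl : ∀ {φ} → φ ≼ φ
    ≼-∧ˡ : ∀ {χ φ ψ} → χ ≼ φ → χ ≼ (φ ∧ᶠ ψ)
    ≼-∧ʳ : ∀ {χ φ ψ} → χ ≼ ψ → χ ≼ (φ ∧ᶠ ψ)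
    ≼-∨ˡ : ∀ {χ φ ψ} → χ ≼ φ → χ ≼ (φ ∨ᶠ ψ)
    ≼-∨ʳ : ∀ {χ φ ψ} → χ ≼ ψ → χ ≼ (φ ∨ᶠ ψ)
    ≼-dia : ∀ {χ φ} → χ ≼ φ → χ ≼ dia φ
    ≼-box : ∀ {χ φ} → χ ≼ φ → χ ≼ box φ
    ≼-mu : ∀ {χ X φ} → χ ≼ φ → χ ≼ mu X φ
    ≼-nu : ∀ {χ X φ} → χ ≼ φ → χ ≼ nu X φ

  data Free (X : Var) : Formula P → Set where
    fr-var : Free X (var X)
    fr-∧ˡ : ∀ {φ ψ} → Free X φ → Free X (φ ∧ᶠ ψ)
    fr-∧ʳ : ∀ {φ ψ} → Free X ψ → Free X (φ ∧ᶠ ψ)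
    fr-∨ˡ : ∀ {φ ψ} → Free X φ → Free X (φ ∨ᶠ ψ)
    fr-∨ʳ : ∀ {φ ψ} → Free X ψ → Free X (φ ∨ᶠ ψ)
    fr-dia : ∀ {φ} → Free X φ → Free X (dia φ)
    fr-box : ∀ {φ} → Free X φ → Free X (box φ)
    fr-mu : ∀ {Y φ} → X ≢ Y → Free X φ → Free X (mu Y φ)
    fr-nu : ∀ {Y φ} → X ≢ Y → Free X φ → Free X (nu Y φ)

  data UFree (X : Var) : Formula P → Set where
    uf-var : UFree X (var X)
    uf-∧ˡ : ∀ {φ ψ} → UFree X φ → UFree X (φ ∧ᶠ ψ)
    uf-∧ʳ : ∀ {φ ψ} → UFree X ψ → UFree X (φ ∧ᶠ ψ)
    uf-∨ˡ : ∀ {φ ψ} → UFree X φ → UFree X (φ ∨ᶠ ψ)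
    uf-∨ʳ : ∀ {φ ψ} → UFree X ψ → UFree X (φ ∨ᶠ ψ)
    uf-mu : ∀ {Y φ} → X ≢ Y → UFree X φ → UFree X (mu Y φ)
    uf-nu : ∀ {Y φ} → X ≢ Y → UFree X φ → UFree X (nu Y φ)

  BindsIn : Var → Formula P → Formula P → Set
  BindsIn X φ Ψ = (mu X φ ≼ Ψ) ⊎ (nu X φ ≼ Ψ)

  Sentence : Formula P → Set
  Sentence Ψ = ∀ X → ¬ Free X Ψ

  Guarded : Formula P → Set
  Guarded Ψ = ∀ X φ → BindsIn X φ Ψ → ¬ UFree X φ

  binderVar : Formula P → Maybe Var
  binderVar (mu X _) = just X
  binderVar (nu X _) = just X
  binderVar _        = nothing

  -- each fixpoint variable has a unique binding subformula in Ψ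
  -- (so that the position (s , X) of the game has a well-defined successor)
  WellNamed : Formula P → Set
  WellNamed Ψ = ∀ χ χ' X → χ ≼ Ψ → χ' ≼ Ψ →
                binderVar χ ≡ just X → binderVar χ' ≡ just X → χ ≡ χ'

  body : Formula P → Var → Maybe (Formula P)
  body (mu Y φ) X = if X ≡ᵇ Y then just φ else body φ X
  body (nu Y φ) X = if X ≡ᵇ Y then just φ else body φ X
  body (φ ∧ᶠ ψ) X with body φ X
  ... | just χ  = just χ
  ... | nothing = body ψ X
  body (φ ∨ᶠ ψ) X with body φ X
  ... | just χ  = just χ
  ... | nothing = body ψ X
  body (dia φ) X = body φ X
  body (box φ) X = body φ X
  body _ _ = nothing

record Kripke (P : Set) : Set₁ where
  field
    State : Set
    succ  : State → List State
    lab   : State → P → Bool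
    root  : State

-- Brouwer ordinals (enough for closure ordinals on countable structures)
data Ord : Set where
  oz : Ord
  os : Ord → Ord
  ol : (ℕ → Ord) → Ord

module Semantics {P : Set} (K : Kripke P) where
  open Kripke K

  Env : Set₁
  Env = Var → State → Set

  _[_↦_] : Env → Var → (State → Set) → Env
  (ρ [ X ↦ S ]) Y = if X ≡ᵇ Y then S else ρ Y

  mutual
    Sat : Formula P → Env → State → Set
    Sat (prop p)  ρ s = T (lab s p)
    Sat (nprop p) ρ s = T (not (lab s p))
    Sat (var X)   ρ s = ρ X s
    Sat (φ ∧ᶠ ψ)  ρ s = Sat φ ρ s × Sat ψ ρ s
    Sat (φ ∨ᶠ ψ)  ρ s = Sat φ ρ s ⊎ Sat ψ ρ s
    Sat (dia φ)   ρ s = Any (Sat φ ρ) (succ s)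
    Sat (box φ)   ρ s = All (Sat φ ρ) (succ s)
    Sat (mu X φ)  ρ s = Σ Ord λ α → MuApp X φ ρ α s
    Sat (nu X φ)  ρ s = (α : Ord) → NuApp X φ ρ α s
    Sat bot       ρ s = ⊥
    Sat top       ρ s = ⊤

    MuApp : Var → Formula P → Env → Ord → State → Set
    MuApp X φ ρ oz     s = ⊥
    MuApp X φ ρ (os α) s = Sat φ (ρ [ X ↦ MuApp X φ ρ α ]) s
    MuApp X φ ρ (ol f) s = Σ ℕ λ n → MuApp X φ ρ (f n) s

    NuApp : Var → Formula P → Env → Ord → State → Set
    NuApp X φ ρ oz     s = ⊤
    NuApp X φ ρ (os α) s = Sat φ (ρ [ X ↦ NuApp X φ ρ α ]) s
    NuApp X φ ρ (ol f) s = (n : ℕ) → NuApp X φ ρ (f n) s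

  emptyEnv : Env
  emptyEnv _ _ = ⊥

_⊨_ : {P : Set} → Kripke P → Formula P → Set
K ⊨ φ = Semantics.Sat K φ (Semantics.emptyEnv K) (Kripke.root K)

record Tree : Set where
  coinductive
  field
    label    : ℕ → Bool
    children : List Tree

open Tree

treeK : Tree → Kripke ℕ
treeK t = record { State = Tree ; succ = children ; lab = label ; root = t }

SemModal : Formula ℕ → Set
SemModal Ψ = Σ (Formula ℕ) λ χ → FixFree χ × ((t : Tree) → treeK t ⊨ Ψ ⇔ treeK t ⊨ χ)

_isOdd : ℕ → Set
n isOdd = n % 2 ≡ 1

_isEven : ℕ → Set
n isEven = n % 2 ≡ 0

record PriorityAssignment (Ψ : Formula ℕ) : Set where
  field
    Ω : Var → ℕ
    m q : ℕ
    m≤1 : m ≤ 1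
    range : ∀ X φ → BindsIn X φ Ψ → (m ≤ Ω X) × (Ω X ≤ q)
    muOdd  : ∀ X φ → mu X φ ≼ Ψ → Ω X isOdd
    nuEven : ∀ X φ → nu X φ ≼ Ψ → Ω X isEven
    orderPres : ∀ X Y φ ψ → BindsIn X φ Ψ → BindsIn Y ψ Ψ → Free X ψ → Ω Y ≤ Ω X

data AProp : Set where
  E : ℕ → AProp
  O : ℕ → AProp
  M : AProp

module Arena (Ψ : Formula ℕ) (Ωa : PriorityAssignment Ψ) where
  open PriorityAssignment Ωa

  Pos : Set
  Pos = Tree × Formula ℕ

  moves : Pos → List Pos
  moves (s , prop _)  = []
  moves (s , nprop _) = []
  moves (s , var X) with body Ψ X
  ... | just φ  = (s , φ) ∷ []
  ... | nothing = []
  moves (s , φ ∧ᶠ ψ)  = (s , φ) ∷ (s , ψ) ∷ []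
  moves (s , φ ∨ᶠ ψ)  = (s , φ) ∷ (s , ψ) ∷ []
  moves (s , dia φ)   = map (λ t → (t , φ)) (children s)
  moves (s , box φ)   = map (λ t → (t , φ)) (children s)
  moves (s , mu X φ)  = (s , φ) ∷ []
  moves (s , nu X φ)  = (s , φ) ∷ []
  moves (s , bot)     = []
  moves (s , top)     = []

  isOddPos : Pos → Bool
  isOddPos (s , prop p)  = label s p
  isOddPos (s , nprop p) = not (label s p)
  isOddPos (s , _ ∧ᶠ _)  = true
  isOddPos (s , box _)   = true
  isOddPos (s , top)     = true
  isOddPos _             = false

  priority : Pos → ℕ
  priority (s , var X) = Ω X
  priority _           = m

  isModal : Pos → Bool
  isModal (_ , dia _) = true
  isModal (_ , box _) = true
  isModal _           = false

  alab : Pos → AProp → Bool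
  alab x (E i) = not (isOddPos x) ∧ (priority x ≡ᵇ i)
  alab x (O i) = isOddPos x ∧ (priority x ≡ᵇ i)
  alab x M     = isModal x

  game : Tree → Kripke AProp
  game t = record { State = Pos ; succ = moves ; lab = alab ; root = (t , Ψ) }

_×ᵍ_[_] : Tree → (Ψ : Formula ℕ) → PriorityAssignment Ψ → Kripke AProp
t ×ᵍ Ψ [ Ωa ] = Arena.game Ψ Ωa t

-- Let χ be a modal formula equivalent to Ψ, of modal depth d. As χ only sees the first d
-- levels of a tree, 𝔗 ⊨ Ψ iff 𝔗↾d ⊨ Ψ, where 𝔗↾d is 𝔗 cut off below depth d. On a tree of
-- finite depth a guarded fixpoint is reached after finitely many approximation steps and is
-- the unique solution of its equation, so μ- and ν-formulas may both be evaluated by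
-- unfolding. Hence 𝔗↾d ⊨ Ψ iff Even wins 𝔗 × Ψ when the play is stopped at the first modal
-- position after d modal moves, a stopped □-position counting as won and a stopped
-- ◇-position as lost. By guardedness, at most K non-modal moves, with K depending only on Ψ,
-- separate two modal moves, so this finite game is described by a fixpoint-free formula in
-- O_m and M.

{-# OPTIONS --safe #-}
module Submission where

open import Defs
open import Data.Bool using (true; false; T)
open import Data.Empty using (⊥; ⊥-elim)
open import Data.List using (List; []; _∷_; [_]; map)
open import Data.List.Relation.Unary.Any as Any using (Any; here; there)
open import Data.List.Relation.Unary.All as All using (All; []; _∷_)
import Data.List.Relation.Unary.Any.Properties as Anyₚ
import Data.List.Relation.Unary.All.Properties as Allₚ
open import Data.Maybe using (just; nothing)
open import Data.Maybe.Properties using (just-injective)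
open import Data.Nat using (ℕ; zero; suc; _≤_; _<_; _⊔_; _∸_; _≡ᵇ_; s≤s; s≤s⁻¹)
open import Data.Nat.Induction using (<-rec)
open import Data.Nat.Properties
  using (≤-refl; ≤-trans; <⇒≤; <-irrefl; <-trans; ≤-<-trans; m≤m⊔n; m≤n⊔m;
         m⊔n<o⇒m<o; m⊔n<o⇒n<o; ∸-monoʳ-<; m∸n≤m; m<n⇒0<n∸m; n≤1+n; ≡ᵇ⇒≡; ≡⇒≡ᵇ; _≟_)
open import Data.Product using (Σ; _×_; _,_; proj₁; proj₂)
open import Data.Product.Function.NonDependent.Propositional using (_×-⇔_)
open import Data.Sum as Sum using (_⊎_; inj₁; inj₂)
open import Data.Sum.Function.Propositional using (_⊎-⇔_)
open import Data.Unit using (tt)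
open import Function using (_∘_; id)
open import Function.Bundles using (_⇔_; mk⇔; Equivalence)
import Function.Properties.Equivalence as ⇔
open import Function.Properties.Inverse using (↔⇒⇔)
open import Level using (0ℓ)
import Relation.Binary.Reasoning.Setoid
open import Relation.Binary.PropositionalEquality
  using (_≡_; _≢_; refl; sym; trans; cong; cong₂; subst; module ≡-Reasoning)
open import Relation.Nullary using (¬_; yes; no)
open Tree

module ⇔-Reasoning = Relation.Binary.Reasoning.Setoid (⇔.⇔-setoid 0ℓ)

module _ {A : Set} {D P Q : A → Set} where

  Any-mono-on : ∀ {xs} → (∀ {x} → D x → P x → Q x) → All D xs → Any P xs → Any Q xs
  Any-mono-on f (d ∷ _)  (here p)  = here (f d p)
  Any-mono-on f (_ ∷ ds) (there p) = there (Any-mono-on f ds p)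

  All-mono-on : ∀ {xs} → (∀ {x} → D x → P x → Q x) → All D xs → All P xs → All Q xs
  All-mono-on f []       []       = []
  All-mono-on f (d ∷ ds) (p ∷ ps) = f d p ∷ All-mono-on f ds ps

module _ {A B : Set} {P : B → Set} {f : A → B} {xs : List A} where

  Any-map⇔ : Any P (map f xs) ⇔ Any (P ∘ f) xs
  Any-map⇔ = ⇔.sym (↔⇒⇔ Anyₚ.map↔)

  All-map⇔ : All P (map f xs) ⇔ All (P ∘ f) xs
  All-map⇔ = mk⇔ Allₚ.map⁻ Allₚ.map⁺

module _ {A : Set} {P Q : A → Set} {xs : List A} where

  Any-cong : (∀ x → P x ⇔ Q x) → Any P xs ⇔ Any Q xs
  Any-cong P⇔Q = mk⇔ (Any.map (Equivalence.to (P⇔Q _))) (Any.map (Equivalence.from (P⇔Q _)))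

  All-cong : (∀ x → P x ⇔ Q x) → All P xs ⇔ All Q xs
  All-cong P⇔Q = mk⇔ (All.map (Equivalence.to (P⇔Q _))) (All.map (Equivalence.from (P⇔Q _)))

-- Syntax

module _ {P : Set} where

  size : Formula P → ℕ
  size (φ ∧ᶠ ψ) = suc (size φ ⊔ size ψ)
  size (φ ∨ᶠ ψ) = suc (size φ ⊔ size ψ)
  size (dia φ)  = suc (size φ)
  size (box φ)  = suc (size φ)
  size (mu _ φ) = suc (size φ)
  size (nu _ φ) = suc (size φ)
  size _        = 0

  ≼-trans : {φ ψ χ : Formula P} → φ ≼ ψ → ψ ≼ χ → φ ≼ χ
  ≼-trans p ≼-refl    = p
  ≼-trans p (≼-∧ˡ q)  = ≼-∧ˡ (≼-trans p q)
  ≼-trans p (≼-∧ʳ q)  = ≼-∧ʳ (≼-trans p q)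
  ≼-trans p (≼-∨ˡ q)  = ≼-∨ˡ (≼-trans p q)
  ≼-trans p (≼-∨ʳ q)  = ≼-∨ʳ (≼-trans p q)
  ≼-trans p (≼-dia q) = ≼-dia (≼-trans p q)
  ≼-trans p (≼-box q) = ≼-box (≼-trans p q)
  ≼-trans p (≼-mu q)  = ≼-mu (≼-trans p q)
  ≼-trans p (≼-nu q)  = ≼-nu (≼-trans p q)

  mutual
    ≼⇒≡⊎size< : {χ φ : Formula P} → χ ≼ φ → χ ≡ φ ⊎ size χ < size φ
    ≼⇒≡⊎size< ≼-refl = inj₁ refl
    ≼⇒≡⊎size< (≼-∧ˡ p) = inj₂ (s≤s (≤-trans (≼⇒size≤ p) (m≤m⊔n _ _)))
    ≼⇒≡⊎size< (≼-∧ʳ p) = inj₂ (s≤s (≤-trans (≼⇒size≤ p) (m≤n⊔m _ _)))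
    ≼⇒≡⊎size< (≼-∨ˡ p) = inj₂ (s≤s (≤-trans (≼⇒size≤ p) (m≤m⊔n _ _)))
    ≼⇒≡⊎size< (≼-∨ʳ p) = inj₂ (s≤s (≤-trans (≼⇒size≤ p) (m≤n⊔m _ _)))
    ≼⇒≡⊎size< (≼-dia p) = inj₂ (s≤s (≼⇒size≤ p))
    ≼⇒≡⊎size< (≼-box p) = inj₂ (s≤s (≼⇒size≤ p))
    ≼⇒≡⊎size< (≼-mu p)  = inj₂ (s≤s (≼⇒size≤ p))
    ≼⇒≡⊎size< (≼-nu p)  = inj₂ (s≤s (≼⇒size≤ p))

    ≼⇒size≤ : {χ φ : Formula P} → χ ≼ φ → size χ ≤ size φ
    ≼⇒size≤ p with ≼⇒≡⊎size< p
    ... | inj₁ refl = ≤-refl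
    ... | inj₂ lt   = <⇒≤ lt

  data Fixpoint : Formula P → Var → Formula P → Set where
    μ-fix : ∀ {X ψ} → Fixpoint (mu X ψ) X ψ
    ν-fix : ∀ {X ψ} → Fixpoint (nu X ψ) X ψ

  module _ {σ : Formula P} {X : Var} {ψ : Formula P} where

    Fixpoint-binderVar : Fixpoint σ X ψ → binderVar σ ≡ just X
    Fixpoint-binderVar μ-fix = refl
    Fixpoint-binderVar ν-fix = refl

    Fixpoint-body≼ : Fixpoint σ X ψ → ψ ≼ σ
    Fixpoint-body≼ μ-fix = ≼-mu ≼-refl
    Fixpoint-body≼ ν-fix = ≼-nu ≼-refl

    Fixpoint-size : Fixpoint σ X ψ → size ψ < size σ
    Fixpoint-size μ-fix = ≤-refl
    Fixpoint-size ν-fix = ≤-refl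

    Fixpoint-free : ∀ {Y} → Fixpoint σ X ψ → Y ≢ X → Free Y ψ → Free Y σ
    Fixpoint-free μ-fix = fr-mu
    Fixpoint-free ν-fix = fr-nu

    Fixpoint-ufree : ∀ {Y} → Fixpoint σ X ψ → Y ≢ X → UFree Y ψ → UFree Y σ
    Fixpoint-ufree μ-fix = uf-mu
    Fixpoint-ufree ν-fix = uf-nu

    Fixpoint⇒BindsIn : ∀ {Φ} → Fixpoint σ X ψ → σ ≼ Φ → BindsIn X ψ Φ
    Fixpoint⇒BindsIn μ-fix = inj₁
    Fixpoint⇒BindsIn ν-fix = inj₂

  Fixpoint-unique : ∀ {σ σ' X ψ ψ'} → Fixpoint σ X ψ → Fixpoint σ' X ψ' → σ ≡ σ' →
                    ψ ≡ ψ'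
  Fixpoint-unique μ-fix μ-fix refl = refl
  Fixpoint-unique ν-fix ν-fix refl = refl

  BindsIn⇒Fixpoint : ∀ {X ψ Φ} → BindsIn X ψ Φ →
                     Σ (Formula P) λ σ → Fixpoint σ X ψ × σ ≼ Φ
  BindsIn⇒Fixpoint (inj₁ p) = _ , μ-fix , p
  BindsIn⇒Fixpoint (inj₂ p) = _ , ν-fix , p

  BindsIn-≼ : ∀ {X ψ Φ Φ'} → BindsIn X ψ Φ → Φ ≼ Φ' → BindsIn X ψ Φ'
  BindsIn-≼ (inj₁ p) q = inj₁ (≼-trans p q)
  BindsIn-≼ (inj₂ p) q = inj₂ (≼-trans p q)

  BindsIn⇒body≼ : ∀ {X ψ Φ} → BindsIn X ψ Φ → ψ ≼ Φ
  BindsIn⇒body≼ (inj₁ p) = ≼-trans (≼-mu ≼-refl) p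
  BindsIn⇒body≼ (inj₂ p) = ≼-trans (≼-nu ≼-refl) p

  UFree⇒Free : ∀ {X} {φ : Formula P} → UFree X φ → Free X φ
  UFree⇒Free uf-var      = fr-var
  UFree⇒Free (uf-∧ˡ u)   = fr-∧ˡ (UFree⇒Free u)
  UFree⇒Free (uf-∧ʳ u)   = fr-∧ʳ (UFree⇒Free u)
  UFree⇒Free (uf-∨ˡ u)   = fr-∨ˡ (UFree⇒Free u)
  UFree⇒Free (uf-∨ʳ u)   = fr-∨ʳ (UFree⇒Free u)
  UFree⇒Free (uf-mu n u) = fr-mu n (UFree⇒Free u)
  UFree⇒Free (uf-nu n u) = fr-nu n (UFree⇒Free u)

  BoundIn : Var → Formula P → (Formula P → Set) → Set
  BoundIn Y φ A = Σ (Formula P) λ ψ → BindsIn Y ψ φ × A ψ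

  enclose : ∀ {Y φ φ' A} → φ ≼ φ' → BoundIn Y φ A → BoundIn Y φ' A
  enclose c (ψ , b , a) = ψ , BindsIn-≼ b c , a

  Free-≼ : ∀ {Y} {χ φ : Formula P} → χ ≼ φ → Free Y χ → Free Y φ ⊎ BoundIn Y φ (χ ≼_)
  Free-≼ ≼-refl   f = inj₁ f
  Free-≼ (≼-∧ˡ p)  f = Sum.map fr-∧ˡ  (enclose (≼-∧ˡ ≼-refl))  (Free-≼ p f)
  Free-≼ (≼-∧ʳ p)  f = Sum.map fr-∧ʳ  (enclose (≼-∧ʳ ≼-refl))  (Free-≼ p f)
  Free-≼ (≼-∨ˡ p)  f = Sum.map fr-∨ˡ  (enclose (≼-∨ˡ ≼-refl))  (Free-≼ p f)
  Free-≼ (≼-∨ʳ p)  f = Sum.map fr-∨ʳ  (enclose (≼-∨ʳ ≼-refl))  (Free-≼ p f)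
  Free-≼ (≼-dia p) f = Sum.map fr-dia (enclose (≼-dia ≼-refl)) (Free-≼ p f)
  Free-≼ (≼-box p) f = Sum.map fr-box (enclose (≼-box ≼-refl)) (Free-≼ p f)
  Free-≼ {Y} (≼-mu {X = Z} {φ = φ} p) f with Free-≼ p f
  ... | inj₂ bound = inj₂ (enclose (≼-mu ≼-refl) bound)
  ... | inj₁ g with Y ≟ Z
  ...   | yes refl = inj₂ (φ , inj₁ ≼-refl , p)
  ...   | no Y≢Z   = inj₁ (fr-mu Y≢Z g)
  Free-≼ {Y} (≼-nu {X = Z} {φ = φ} p) f with Free-≼ p f
  ... | inj₂ bound = inj₂ (enclose (≼-nu ≼-refl) bound)
  ... | inj₁ g with Y ≟ Z
  ...   | yes refl = inj₂ (φ , inj₂ ≼-refl , p)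
  ...   | no Y≢Z   = inj₁ (fr-nu Y≢Z g)

  -- Occurrences outside every modality, ignoring binders: the variables that a play from (s , φ)
  -- may visit before its next modal move.
  data UOcc (Y : Var) : Formula P → Set where
    uo-var : UOcc Y (var Y)
    uo-∧ˡ  : ∀ {φ ψ} → UOcc Y φ → UOcc Y (φ ∧ᶠ ψ)
    uo-∧ʳ  : ∀ {φ ψ} → UOcc Y ψ → UOcc Y (φ ∧ᶠ ψ)
    uo-∨ˡ  : ∀ {φ ψ} → UOcc Y φ → UOcc Y (φ ∨ᶠ ψ)
    uo-∨ʳ  : ∀ {φ ψ} → UOcc Y ψ → UOcc Y (φ ∨ᶠ ψ)
    uo-mu  : ∀ {Z φ} → UOcc Y φ → UOcc Y (mu Z φ)
    uo-nu  : ∀ {Z φ} → UOcc Y φ → UOcc Y (nu Z φ)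

  UOcc⇒UFree⊎bound : ∀ {Y} {φ : Formula P} → UOcc Y φ → UFree Y φ ⊎ BoundIn Y φ (UOcc Y)
  UOcc⇒UFree⊎bound uo-var   = inj₁ uf-var
  UOcc⇒UFree⊎bound (uo-∧ˡ o) = Sum.map uf-∧ˡ (enclose (≼-∧ˡ ≼-refl)) (UOcc⇒UFree⊎bound o)
  UOcc⇒UFree⊎bound (uo-∧ʳ o) = Sum.map uf-∧ʳ (enclose (≼-∧ʳ ≼-refl)) (UOcc⇒UFree⊎bound o)
  UOcc⇒UFree⊎bound (uo-∨ˡ o) = Sum.map uf-∨ˡ (enclose (≼-∨ˡ ≼-refl)) (UOcc⇒UFree⊎bound o)
  UOcc⇒UFree⊎bound (uo-∨ʳ o) = Sum.map uf-∨ʳ (enclose (≼-∨ʳ ≼-refl)) (UOcc⇒UFree⊎bound o)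
  UOcc⇒UFree⊎bound {Y} (uo-mu {Z} {φ} o) with UOcc⇒UFree⊎bound o
  ... | inj₂ bound = inj₂ (enclose (≼-mu ≼-refl) bound)
  ... | inj₁ u with Y ≟ Z
  ...   | yes refl = inj₂ (φ , inj₁ ≼-refl , o)
  ...   | no Y≢Z   = inj₁ (uf-mu Y≢Z u)
  UOcc⇒UFree⊎bound {Y} (uo-nu {Z} {φ} o) with UOcc⇒UFree⊎bound o
  ... | inj₂ bound = inj₂ (enclose (≼-nu ≼-refl) bound)
  ... | inj₁ u with Y ≟ Z
  ...   | yes refl = inj₂ (φ , inj₂ ≼-refl , o)
  ...   | no Y≢Z   = inj₁ (uf-nu Y≢Z u)

  body-sound : ∀ φ Y {ψ} → body φ Y ≡ just ψ → BindsIn Y ψ φ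
  body-sound (φ ∧ᶠ φ') Y e with body φ Y in e'
  ... | just _  = BindsIn-≼ (body-sound φ Y (trans e' e)) (≼-∧ˡ ≼-refl)
  ... | nothing = BindsIn-≼ (body-sound φ' Y e) (≼-∧ʳ ≼-refl)
  body-sound (φ ∨ᶠ φ') Y e with body φ Y in e'
  ... | just _  = BindsIn-≼ (body-sound φ Y (trans e' e)) (≼-∨ˡ ≼-refl)
  ... | nothing = BindsIn-≼ (body-sound φ' Y e) (≼-∨ʳ ≼-refl)
  body-sound (dia φ) Y e = BindsIn-≼ (body-sound φ Y e) (≼-dia ≼-refl)
  body-sound (box φ) Y e = BindsIn-≼ (body-sound φ Y e) (≼-box ≼-refl)
  body-sound (mu Z φ) Y e with Y ≡ᵇ Z | ≡ᵇ⇒≡ Y Z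
  ... | false | _ = BindsIn-≼ (body-sound φ Y e) (≼-mu ≼-refl)
  ... | true | Y≡Z with Y≡Z _ | e
  ...   | refl | refl = inj₁ ≼-refl
  body-sound (nu Z φ) Y e with Y ≡ᵇ Z | ≡ᵇ⇒≡ Y Z
  ... | false | _ = BindsIn-≼ (body-sound φ Y e) (≼-nu ≼-refl)
  ... | true | Y≡Z with Y≡Z _ | e
  ...   | refl | refl = inj₂ ≼-refl

  body-bound : ∀ {σ Y ψ} φ → σ ≼ φ → Fixpoint σ Y ψ → body φ Y ≢ nothing
  body-bound {Y = Y} (mu _ _) ≼-refl μ-fix with Y ≡ᵇ Y | ≡⇒≡ᵇ Y Y refl
  ... | true | _ = λ ()
  body-bound {Y = Y} (nu _ _) ≼-refl ν-fix with Y ≡ᵇ Y | ≡⇒≡ᵇ Y Y refl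
  ... | true | _ = λ ()
  body-bound {Y = Y} (φ ∧ᶠ _) (≼-∧ˡ p) fx with body φ Y | body-bound φ p fx
  ... | just _  | _       = λ ()
  ... | nothing | defined = ⊥-elim (defined refl)
  body-bound {Y = Y} (φ ∧ᶠ φ') (≼-∧ʳ p) fx with body φ Y
  ... | just _  = λ ()
  ... | nothing = body-bound φ' p fx
  body-bound {Y = Y} (φ ∨ᶠ _) (≼-∨ˡ p) fx with body φ Y | body-bound φ p fx
  ... | just _  | _       = λ ()
  ... | nothing | defined = ⊥-elim (defined refl)
  body-bound {Y = Y} (φ ∨ᶠ φ') (≼-∨ʳ p) fx with body φ Y
  ... | just _  = λ ()
  ... | nothing = body-bound φ' p fx
  body-bound (dia φ) (≼-dia p) fx = body-bound φ p fx
  body-bound (box φ) (≼-box p) fx = body-bound φ p fx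
  body-bound {Y = Y} (mu Z φ) (≼-mu p) fx with Y ≡ᵇ Z
  ... | true  = λ ()
  ... | false = body-bound φ p fx
  body-bound {Y = Y} (nu Z φ) (≼-nu p) fx with Y ≡ᵇ Z
  ... | true  = λ ()
  ... | false = body-bound φ p fx

-- Ranks

module _ {P : Set} where

  rankWith : (Var → ℕ) → Formula P → ℕ
  rankWith r (var X)  = r X
  rankWith r (φ ∧ᶠ ψ) = suc (rankWith r φ ⊔ rankWith r ψ)
  rankWith r (φ ∨ᶠ ψ) = suc (rankWith r φ ⊔ rankWith r ψ)
  rankWith r (mu _ φ) = suc (rankWith r φ)
  rankWith r (nu _ φ) = suc (rankWith r φ)
  rankWith r _        = 0

  rankWith-cong : ∀ {r r'} φ → (∀ Y → UOcc Y φ → r Y ≡ r' Y) →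
                  rankWith r φ ≡ rankWith r' φ
  rankWith-cong (var X)  h = h X uo-var
  rankWith-cong (φ ∧ᶠ ψ) h = cong suc (cong₂ _⊔_ (rankWith-cong φ (λ Y → h Y ∘ uo-∧ˡ))
                                                 (rankWith-cong ψ (λ Y → h Y ∘ uo-∧ʳ)))
  rankWith-cong (φ ∨ᶠ ψ) h = cong suc (cong₂ _⊔_ (rankWith-cong φ (λ Y → h Y ∘ uo-∨ˡ))
                                                 (rankWith-cong ψ (λ Y → h Y ∘ uo-∨ʳ)))
  rankWith-cong (mu _ φ) h = cong suc (rankWith-cong φ (λ Y → h Y ∘ uo-mu))
  rankWith-cong (nu _ φ) h = cong suc (rankWith-cong φ (λ Y → h Y ∘ uo-nu))
  rankWith-cong (prop _)  h = refl
  rankWith-cong (nprop _) h = refl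
  rankWith-cong (dia _)   h = refl
  rankWith-cong (box _)   h = refl
  rankWith-cong bot       h = refl
  rankWith-cong top       h = refl

  rankWith-Fixpoint : ∀ r {σ X ψ} → Fixpoint σ X ψ → rankWith r σ ≡ suc (rankWith r ψ)
  rankWith-Fixpoint r μ-fix = refl
  rankWith-Fixpoint r ν-fix = refl

  mutual
    maxOver : (Formula P → ℕ) → Formula P → ℕ
    maxOver f φ = f φ ⊔ maxBelow f φ

    maxBelow : (Formula P → ℕ) → Formula P → ℕ
    maxBelow f (φ ∧ᶠ ψ) = maxOver f φ ⊔ maxOver f ψ
    maxBelow f (φ ∨ᶠ ψ) = maxOver f φ ⊔ maxOver f ψ
    maxBelow f (dia φ)  = maxOver f φ
    maxBelow f (box φ)  = maxOver f φ
    maxBelow f (mu _ φ) = maxOver f φ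
    maxBelow f (nu _ φ) = maxOver f φ
    maxBelow f _        = 0

  maxBelow≤maxOver : ∀ f φ → maxBelow f φ ≤ maxOver f φ
  maxBelow≤maxOver f φ = m≤n⊔m (f φ) (maxBelow f φ)

  ≼⇒≤maxOver : ∀ (f : Formula P → ℕ) {χ φ} → χ ≼ φ → f χ ≤ maxOver f φ
  ≼⇒≤maxOver f {φ = φ} ≼-refl = m≤m⊔n (f φ) (maxBelow f φ)
  ≼⇒≤maxOver f (≼-∧ˡ {φ = φ} {ψ} p) =
    ≤-trans (≼⇒≤maxOver f p) (≤-trans (m≤m⊔n (maxOver f φ) _) (maxBelow≤maxOver f (φ ∧ᶠ ψ)))
  ≼⇒≤maxOver f (≼-∧ʳ {φ = φ} {ψ} p) =
    ≤-trans (≼⇒≤maxOver f p) (≤-trans (m≤n⊔m (maxOver f φ) _) (maxBelow≤maxOver f (φ ∧ᶠ ψ)))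
  ≼⇒≤maxOver f (≼-∨ˡ {φ = φ} {ψ} p) =
    ≤-trans (≼⇒≤maxOver f p) (≤-trans (m≤m⊔n (maxOver f φ) _) (maxBelow≤maxOver f (φ ∨ᶠ ψ)))
  ≼⇒≤maxOver f (≼-∨ʳ {φ = φ} {ψ} p) =
    ≤-trans (≼⇒≤maxOver f p) (≤-trans (m≤n⊔m (maxOver f φ) _) (maxBelow≤maxOver f (φ ∨ᶠ ψ)))
  ≼⇒≤maxOver f (≼-dia {φ = φ} p) = ≤-trans (≼⇒≤maxOver f p) (maxBelow≤maxOver f (dia φ))
  ≼⇒≤maxOver f (≼-box {φ = φ} p) = ≤-trans (≼⇒≤maxOver f p) (maxBelow≤maxOver f (box φ))
  ≼⇒≤maxOver f (≼-mu {X = X} {φ} p) = ≤-trans (≼⇒≤maxOver f p) (maxBelow≤maxOver f (mu X φ))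
  ≼⇒≤maxOver f (≼-nu {X = X} {φ} p) = ≤-trans (≼⇒≤maxOver f p) (maxBelow≤maxOver f (nu X φ))

module WellNamedSentence {P : Set} (Ψ : Formula P)
  (sentence : Sentence Ψ) (guarded : Guarded Ψ) (wellNamed : WellNamed Ψ) where

  binding-unique : ∀ {Y ψ ψ'} → BindsIn Y ψ Ψ → BindsIn Y ψ' Ψ → ψ ≡ ψ'
  binding-unique b b' with BindsIn⇒Fixpoint b | BindsIn⇒Fixpoint b'
  ... | σ , fx , p | σ' , fx' , p' =
    Fixpoint-unique fx fx' (wellNamed σ σ' _ p p' (Fixpoint-binderVar fx) (Fixpoint-binderVar fx'))

  body-binding : ∀ {Y ψ} → BindsIn Y ψ Ψ → body Ψ Y ≡ just ψ
  body-binding {Y} b with BindsIn⇒Fixpoint b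
  ... | σ , fx , p with body Ψ Y in e | body-bound Ψ p fx
  ...   | nothing | defined = ⊥-elim (defined refl)
  ...   | just _  | _       = cong just (binding-unique (body-sound Ψ Y e) b)

  body≼ : ∀ {X φX} → body Ψ X ≡ just φX → φX ≼ Ψ
  body≼ {X} e = BindsIn⇒body≼ (body-sound Ψ X e)

  var-body : ∀ {X} → var X ≼ Ψ → Σ (Formula P) λ φX → body Ψ X ≡ just φX
  var-body p with Free-≼ p fr-var
  ... | inj₁ f           = ⊥-elim (sentence _ f)
  ... | inj₂ (ψ , b , _) = ψ , body-binding b

  binder-not-rebound : ∀ {Y ψ ψ'} → BindsIn Y ψ Ψ → ¬ BindsIn Y ψ' ψ
  binder-not-rebound b b' with BindsIn⇒Fixpoint b | BindsIn⇒Fixpoint b'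
  ... | σ , fx , p | σ' , fx' , p'
    with wellNamed σ' σ _ (≼-trans p' (≼-trans (Fixpoint-body≼ fx) p)) p
                   (Fixpoint-binderVar fx') (Fixpoint-binderVar fx)
  ... | refl = <-irrefl refl (≤-<-trans (≼⇒size≤ p') (Fixpoint-size fx))

  unguarded-body-larger : ∀ {X Y φX} → body Ψ X ≡ just φX → UOcc Y φX →
                          Σ (Formula P) λ φY → body Ψ Y ≡ just φY × size φX < size φY
  unguarded-body-larger {Y = Y} e o with UOcc⇒UFree⊎bound o
  ... | inj₁ u with Free-≼ (body≼ e) (UFree⇒Free u)
  ...   | inj₁ f = ⊥-elim (sentence Y f)
  ...   | inj₂ (ψ , b , q) with ≼⇒≡⊎size< q
  ...     | inj₁ refl = ⊥-elim (guarded Y ψ b u)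
  ...     | inj₂ lt   = ψ , body-binding b , lt
  unguarded-body-larger {Y = Y} e o | inj₂ (ψ , b , o') with UOcc⇒UFree⊎bound o'
  ... | inj₁ u            = ⊥-elim (guarded Y ψ (BindsIn-≼ b (body≼ e)) u)
  ... | inj₂ (_ , b' , _) = ⊥-elim (binder-not-rebound (BindsIn-≼ b (body≼ e)) b')

  varRank : (Var → ℕ) → Var → ℕ
  varRank r X with body Ψ X
  ... | just φX = suc (rankWith r φX)
  ... | nothing = 0

  varRank-body : ∀ r {X φX} → body Ψ X ≡ just φX → varRank r X ≡ suc (rankWith r φX)
  varRank-body r {X} e with body Ψ X
  varRank-body r refl | just _ = refl

  -- rank φ bounds the number of non-modal moves from a position (s , φ). It is computed by iterating
  -- varRank: unguarded variables of a binding formula have strictly larger binding formulas, so the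
  -- iteration has settled at X after suc (size Ψ) ∸ size φX rounds.
  iterRank : ℕ → Var → ℕ
  iterRank zero    _ = 0
  iterRank (suc i) = varRank (iterRank i)

  iterRank-stable : ∀ i {X φX} → body Ψ X ≡ just φX → suc (size Ψ) ∸ size φX ≤ i →
                    iterRank i X ≡ iterRank (suc i) X
  iterRank-stable zero e h =
    ⊥-elim (<-irrefl refl (≤-trans (m<n⇒0<n∸m (s≤s (≼⇒size≤ (body≼ e)))) h))
  iterRank-stable (suc i) {φX = φX} e h = begin
    varRank (iterRank i) _               ≡⟨ varRank-body (iterRank i) e ⟩
    suc (rankWith (iterRank i) φX)       ≡⟨ cong suc (rankWith-cong φX stable) ⟩
    suc (rankWith (iterRank (suc i)) φX) ≡⟨ varRank-body (iterRank (suc i)) e ⟨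
    varRank (iterRank (suc i)) _         ∎
    where
    open ≡-Reasoning
    stable : ∀ Y → UOcc Y φX → iterRank i Y ≡ iterRank (suc i) Y
    stable Y o with unguarded-body-larger e o
    ... | φY , eY , lt = iterRank-stable i eY
      (s≤s⁻¹ (≤-trans (∸-monoʳ-< lt (≤-trans (≼⇒size≤ (body≼ eY)) (n≤1+n _))) h))

  rank : Formula P → ℕ
  rank = rankWith (iterRank (suc (size Ψ)))

  rank-var : ∀ {X φX} → body Ψ X ≡ just φX → rank (var X) ≡ suc (rank φX)
  rank-var {φX = φX} e =
    trans (iterRank-stable (suc (size Ψ)) e (m∸n≤m _ (size φX))) (varRank-body _ e)

  K : ℕ
  K = suc (maxOver rank Ψ)

  rank<K : ∀ {φ} → φ ≼ Ψ → rank φ < K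
  rank<K p = s≤s (≼⇒≤maxOver rank p)

-- Trees of finite depth

trunc : ℕ → Tree → Tree
label    (trunc n t)       = label t
children (trunc zero t)    = []
children (trunc (suc n) t) = map (trunc n) (children t)

Depth< : ℕ → Tree → Set
Depth< zero    _ = ⊥
Depth< (suc n) t = All (Depth< n) (children t)

Depth<-suc : ∀ n {t} → Depth< n t → Depth< (suc n) t
Depth<-suc zero    ()
Depth<-suc (suc n) d = All.map (Depth<-suc n) d

Depth<-children : ∀ n {t} → Depth< n t → All (Depth< n) (children t)
Depth<-children zero    ()
Depth<-children (suc n) d = All.map (Depth<-suc n) d

trunc-Depth< : ∀ n t → Depth< (suc n) (trunc n t)
trunc-Depth< zero    t = []
trunc-Depth< (suc n) t = Allₚ.map⁺ (All.universal (trunc-Depth< n) (children t))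

module _ {P : Set} where

  modalDepth : Formula P → ℕ
  modalDepth (φ ∧ᶠ ψ) = modalDepth φ ⊔ modalDepth ψ
  modalDepth (φ ∨ᶠ ψ) = modalDepth φ ⊔ modalDepth ψ
  modalDepth (dia φ)  = suc (modalDepth φ)
  modalDepth (box φ)  = suc (modalDepth φ)
  modalDepth _        = 0

Sat-trunc : ∀ r r' χ → FixFree χ → ∀ n → modalDepth χ ≤ n → ∀ {ρ ρ'} t →
            Semantics.Sat (treeK r) χ ρ t ⇔ Semantics.Sat (treeK r') χ ρ' (trunc n t)
Sat-trunc r r' (prop _)  _ n _ t = ⇔.refl
Sat-trunc r r' (nprop _) _ n _ t = ⇔.refl
Sat-trunc r r' (φ ∧ᶠ ψ) (fφ , fψ) n le t =
  Sat-trunc r r' φ fφ n (≤-trans (m≤m⊔n _ _) le) t ×-⇔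
  Sat-trunc r r' ψ fψ n (≤-trans (m≤n⊔m _ _) le) t
Sat-trunc r r' (φ ∨ᶠ ψ) (fφ , fψ) n le t =
  Sat-trunc r r' φ fφ n (≤-trans (m≤m⊔n _ _) le) t ⊎-⇔
  Sat-trunc r r' ψ fψ n (≤-trans (m≤n⊔m _ _) le) t
Sat-trunc r r' (dia φ) f (suc n) (s≤s le) t =
  ⇔.trans (Any-cong (Sat-trunc r r' φ f n le)) (⇔.sym Any-map⇔)
Sat-trunc r r' (box φ) f (suc n) (s≤s le) t =
  ⇔.trans (All-cong (Sat-trunc r r' φ f n le)) (⇔.sym All-map⇔)
Sat-trunc r r' bot _ n _ t = ⇔.refl
Sat-trunc r r' top _ n _ t = ⇔.refl
Sat-trunc r r' (var _)  ()
Sat-trunc r r' (mu _ _) ()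
Sat-trunc r r' (nu _ _) ()

module TreeSemantics (r : Tree) where
  open Semantics (treeK r) public

  update-mono : ∀ {ρ ρ' : Env} {A A' : Tree → Set} X Y {u} →
                (X ≡ Y → A u → A' u) → (X ≢ Y → ρ Y u → ρ' Y u) →
                (ρ [ X ↦ A ]) Y u → (ρ' [ X ↦ A' ]) Y u
  update-mono X Y eq neq with X ≡ᵇ Y | ≡ᵇ⇒≡ X Y | ≡⇒≡ᵇ X Y
  ... | true  | X≡Y | _   = eq (X≡Y _)
  ... | false | _   | X≢Y = neq X≢Y

  update-≡ : ∀ (ρ : Env) X A → (ρ [ X ↦ A ]) X ≡ A
  update-≡ ρ X A with X ≡ᵇ X | ≡⇒≡ᵇ X X refl
  ... | true | _ = refl

  update-≢ : ∀ (ρ : Env) {X Y} A → X ≢ Y → (ρ [ X ↦ A ]) Y ≡ ρ Y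
  update-≢ ρ {X} {Y} A X≢Y with X ≡ᵇ Y | ≡ᵇ⇒≡ X Y
  ... | true  | X≡Y = ⊥-elim (X≢Y (X≡Y _))
  ... | false | _   = refl

  record Layered (D D' : Tree → Set) : Set where
    field
      children-inner : ∀ {u} → D u → All D' (children u)
      inner-closed   : ∀ {u} → D' u → All D' (children u)
      inner⊆outer    : ∀ {u} → D' u → D u

    inner : Layered D' D'
    inner = record
      { children-inner = inner-closed ; inner-closed = inner-closed ; inner⊆outer = λ d → d }

  open Layered

  EnvLe : (Var → Set) → (D D' : Tree → Set) → Env → Env → Set
  EnvLe G D D' ρ ρ' = ∀ Z {u} → D u → (G Z → D' u) → ρ Z u → ρ' Z u

  EnvLe-update : ∀ {G D D' ρ ρ' A A'} Y → EnvLe G D D' ρ ρ' →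
                 (∀ {u} → D u → A u → A' u) →
                 EnvLe (λ Z → G Z × Z ≢ Y) D D' (ρ [ Y ↦ A ]) (ρ' [ Y ↦ A' ])
  EnvLe-update {ρ = ρ} {ρ'} Y h hA Z d g→D' =
    update-mono {ρ} {ρ'} Y Z (λ _ → hA d) (λ Y≢Z → h Z d (λ gZ → g→D' (gZ , Y≢Z ∘ sym)))

  EnvLe-inner : ∀ {G D D' ρ ρ'} → Layered D D' → EnvLe G D D' ρ ρ' →
                EnvLe (λ _ → ⊥) D' D' ρ ρ'
  EnvLe-inner L h Z d' _ = h Z (inner⊆outer L d') (λ _ → d')

  -- Variables in G are only guarded, so ρ and ρ' need only be compared on D' for them:
  -- the modal step from D into D' is taken before they are looked up.
  mutual
    Sat-mono : ∀ φ {G D D'} {ρ ρ' : Env} → Layered D D' → (∀ Z → G Z → ¬ UFree Z φ) →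
               EnvLe G D D' ρ ρ' → ∀ {u} → D u → Sat φ ρ u → Sat φ ρ' u
    Sat-mono (prop _)  L g h d s = s
    Sat-mono (nprop _) L g h d s = s
    Sat-mono (var X)   L g h d s = h X d (λ gX → ⊥-elim (g X gX uf-var)) s
    Sat-mono (φ ∧ᶠ ψ) L g h d (a , b) =
      Sat-mono φ L (λ Z gZ → g Z gZ ∘ uf-∧ˡ) h d a , Sat-mono ψ L (λ Z gZ → g Z gZ ∘ uf-∧ʳ) h d b
    Sat-mono (φ ∨ᶠ ψ) L g h d (inj₁ a) = inj₁ (Sat-mono φ L (λ Z gZ → g Z gZ ∘ uf-∨ˡ) h d a)
    Sat-mono (φ ∨ᶠ ψ) L g h d (inj₂ b) = inj₂ (Sat-mono ψ L (λ Z gZ → g Z gZ ∘ uf-∨ʳ) h d b)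
    Sat-mono (dia φ) L g h d s =
      Any-mono-on (Sat-mono φ (inner L) (λ _ ()) (EnvLe-inner L h)) (children-inner L d) s
    Sat-mono (box φ) L g h d s =
      All-mono-on (Sat-mono φ (inner L) (λ _ ()) (EnvLe-inner L h)) (children-inner L d) s
    Sat-mono (mu Y φ) L g h d (α , s) =
      α , MuApp-mono φ Y α L (λ Z gZ Z≢Y → g Z gZ ∘ uf-mu Z≢Y) h d s
    Sat-mono (nu Y φ) L g h d s =
      λ α → NuApp-mono φ Y α L (λ Z gZ Z≢Y → g Z gZ ∘ uf-nu Z≢Y) h d (s α)
    Sat-mono bot L g h d ()
    Sat-mono top L g h d s = s

    MuApp-mono : ∀ φ Y α {G D D'} {ρ ρ' : Env} → Layered D D' →
                 (∀ Z → G Z → Z ≢ Y → ¬ UFree Z φ) → EnvLe G D D' ρ ρ' →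
                 ∀ {u} → D u → MuApp Y φ ρ α u → MuApp Y φ ρ' α u
    MuApp-mono φ Y oz     L g h d ()
    MuApp-mono φ Y (os α) L g h d s =
      Sat-mono φ L (λ Z (gZ , Z≢Y) → g Z gZ Z≢Y) (EnvLe-update Y h (MuApp-mono φ Y α L g h)) d s
    MuApp-mono φ Y (ol f) L g h d (n , s) = n , MuApp-mono φ Y (f n) L g h d s

    NuApp-mono : ∀ φ Y α {G D D'} {ρ ρ' : Env} → Layered D D' →
                 (∀ Z → G Z → Z ≢ Y → ¬ UFree Z φ) → EnvLe G D D' ρ ρ' →
                 ∀ {u} → D u → NuApp Y φ ρ α u → NuApp Y φ ρ' α u
    NuApp-mono φ Y oz     L g h d s = tt
    NuApp-mono φ Y (os α) L g h d s =
      Sat-mono φ L (λ Z (gZ , Z≢Y) → g Z gZ Z≢Y) (EnvLe-update Y h (NuApp-mono φ Y α L g h)) d s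
    NuApp-mono φ Y (ol f) L g h d s = λ n → NuApp-mono φ Y (f n) L g h d (s n)

  Depth<-layered : ∀ n → Layered (Depth< (suc n)) (Depth< n)
  Depth<-layered n = record
    { children-inner = λ d → d ; inner-closed = Depth<-children n ; inner⊆outer = Depth<-suc n }

  Sat-update-guarded : ∀ n ψ X (ρ : Env) {A A' : Tree → Set} → ¬ UFree X ψ →
                       (∀ {w} → Depth< n w → A w → A' w) →
                       ∀ {u} → Depth< (suc n) u → Sat ψ (ρ [ X ↦ A ]) u → Sat ψ (ρ [ X ↦ A' ]) u
  Sat-update-guarded n ψ X ρ g h = Sat-mono ψ {G = _≡ X} (Depth<-layered n) (λ { _ refl → g })
    (λ Z _ X-inner → update-mono {ρ} {ρ} X Z (λ X≡Z → h (X-inner (sym X≡Z))) (λ _ s → s))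

  finite : ℕ → Ord
  finite zero    = oz
  finite (suc n) = os (finite n)

  -- On a tree of depth < n the n-th approximant of a guarded fixpoint is already the fixpoint.
  module _ (ψ : Formula ℕ) (X : Var) (ρ : Env) (g : ¬ UFree X ψ) where

    MuApp-finite : ∀ α n {u} → Depth< n u → MuApp X ψ ρ α u → MuApp X ψ ρ (finite n) u
    MuApp-finite α      zero    ()
    MuApp-finite oz     (suc n) d ()
    MuApp-finite (os α) (suc n) d s       = Sat-update-guarded n ψ X ρ g (MuApp-finite α n) d s
    MuApp-finite (ol f) (suc n) d (i , s) = MuApp-finite (f i) (suc n) d s

    NuApp-finite : ∀ α n {u} → Depth< n u → NuApp X ψ ρ (finite n) u → NuApp X ψ ρ α u
    NuApp-finite α      zero    ()
    NuApp-finite oz     (suc n) d s = tt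
    NuApp-finite (os α) (suc n) d s = Sat-update-guarded n ψ X ρ g (NuApp-finite α n) d s
    NuApp-finite (ol f) (suc n) d s = λ i → NuApp-finite (f i) (suc n) d s

    mu-unfold : ∀ n {u} → Depth< (suc n) u →
                Sat (mu X ψ) ρ u ⇔ Sat ψ (ρ [ X ↦ Sat (mu X ψ) ρ ]) u
    mu-unfold n d = mk⇔
      (λ (α , s) → Sat-update-guarded n ψ X ρ g (λ _ s' → finite n , s') d
                     (MuApp-finite α (suc n) d s))
      (λ s → finite (suc n) ,
             Sat-update-guarded n ψ X ρ g (λ d' (α , s') → MuApp-finite α n d' s') d s)

    nu-unfold : ∀ n {u} → Depth< (suc n) u →
                Sat (nu X ψ) ρ u ⇔ Sat ψ (ρ [ X ↦ Sat (nu X ψ) ρ ]) u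
    nu-unfold n d = mk⇔
      (λ s → Sat-update-guarded n ψ X ρ g (λ d' s' α → NuApp-finite α n d' s') d
               (s (finite (suc n))))
      (λ s α → NuApp-finite α (suc n) d
                 (Sat-update-guarded n ψ X ρ g (λ _ s' → s' (finite n)) d s))

  Fixpoint-unfold : ∀ {σ X ψ} → Fixpoint σ X ψ → ¬ UFree X ψ → ∀ n (ρ : Env) {u} →
                    Depth< (suc n) u → Sat σ ρ u ⇔ Sat ψ (ρ [ X ↦ Sat σ ρ ]) u
  Fixpoint-unfold {X = X} {ψ} μ-fix g n ρ = mu-unfold ψ X ρ g n
  Fixpoint-unfold {X = X} {ψ} ν-fix g n ρ = nu-unfold ψ X ρ g n

-- The interpreting formula

module Interpretation (Ψ : Formula ℕ) (sentence : Sentence Ψ) (guarded : Guarded Ψ)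
                      (wellNamed : WellNamed Ψ) (Ωa : PriorityAssignment Ψ) where
  open WellNamedSentence Ψ sentence guarded wellNamed
  open PriorityAssignment Ωa using (m)
  open Arena Ψ Ωa

  -- Odd owns only non-variable positions, which all have priority m; so O m marks exactly
  -- the positions of Odd.
  cpre : Formula AProp → Formula AProp
  cpre F = (prop (O m) ∧ᶠ box F) ∨ᶠ (nprop (O m) ∧ᶠ dia F)

  -- Even wins the play stopped at the first modal position after j modal moves, provided at most k
  -- non-modal moves precede the next modal one (K after each modal move). A stopped □-position counts
  -- as won and a stopped ◇-position as lost, as at a leaf of a tree.
  mutual
    win : ℕ → ℕ → Formula AProp
    win j zero    = bot
    win j (suc k) = (nprop M ∧ᶠ cpre (win j k)) ∨ᶠ (prop M ∧ᶠ winModal j)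

    winModal : ℕ → Formula AProp
    winModal zero    = prop (O m)
    winModal (suc j) = cpre (win j K)

  mutual
    win-FixFree : ∀ j k → FixFree (win j k)
    win-FixFree j zero    = tt
    win-FixFree j (suc k) =
      (tt , (tt , win-FixFree j k) , (tt , win-FixFree j k)) , (tt , winModal-FixFree j)

    winModal-FixFree : ∀ j → FixFree (winModal j)
    winModal-FixFree zero    = tt
    winModal-FixFree (suc j) = (tt , win-FixFree j K) , (tt , win-FixFree j K)

  -- t₀ and r below only fix the roots of game t₀ and treeK r; satisfaction at a given
  -- position does not depend on them.
  module Play (t₀ : Tree) where
    module G = Semantics (game t₀)

    Holds : Formula AProp → Pos → Set
    Holds F = G.Sat F G.emptyEnv

    win-nonmodal : ∀ j k p → isModal p ≡ false →
                   Holds (win j (suc k)) p ⇔ Holds (cpre (win j k)) p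
    win-nonmodal j k p nonmodal rewrite nonmodal =
      mk⇔ (λ { (inj₁ (_ , w)) → w ; (inj₂ (() , _)) }) (λ w → inj₁ (tt , w))

    win-modal : ∀ j k p → isModal p ≡ true → Holds (win j (suc k)) p ⇔ Holds (winModal j) p
    win-modal j k p modal rewrite modal =
      mk⇔ (λ { (inj₁ (() , _)) ; (inj₂ (_ , w)) → w }) (λ w → inj₂ (tt , w))

    cpre-odd : ∀ F p → isOddPos p ≡ true → priority p ≡ m →
               Holds (cpre F) p ⇔ All (Holds F) (moves p)
    cpre-odd F p odd prio rewrite odd | prio with m ≡ᵇ m | ≡⇒≡ᵇ m m refl
    ... | true | _ = mk⇔ (λ { (inj₁ (_ , w)) → w ; (inj₂ (() , _)) }) (λ w → inj₁ (tt , w))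

    cpre-even : ∀ F p → isOddPos p ≡ false → Holds (cpre F) p ⇔ Any (Holds F) (moves p)
    cpre-even F p even rewrite even =
      mk⇔ (λ { (inj₁ (() , _)) ; (inj₂ (_ , w)) → w }) (λ w → inj₂ (tt , w))

    -- A record rather than an abbreviation, so that j, k and p can be inferred from it.
    record Wins (j k : ℕ) (p : Pos) : Set where
      constructor wins
      field holds : Holds (win j k) p

    Wins⇔Holds : ∀ {j k p} → Wins j k p ⇔ Holds (win j k) p
    Wins⇔Holds = mk⇔ Wins.holds wins

    module _ {j k : ℕ} {p : Pos} where

      Wins-odd : isModal p ≡ false → isOddPos p ≡ true → priority p ≡ m →
                 Wins j (suc k) p ⇔ All (Wins j k) (moves p)
      Wins-odd nonmodal odd prio = ⇔.trans Wins⇔Holds (⇔.trans (win-nonmodal j k p nonmodal)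
        (⇔.trans (cpre-odd (win j k) p odd prio) (All-cong (λ _ → ⇔.sym Wins⇔Holds))))

      Wins-even : isModal p ≡ false → isOddPos p ≡ false →
                  Wins j (suc k) p ⇔ Any (Wins j k) (moves p)
      Wins-even nonmodal even = ⇔.trans Wins⇔Holds (⇔.trans (win-nonmodal j k p nonmodal)
        (⇔.trans (cpre-even (win j k) p even) (Any-cong (λ _ → ⇔.sym Wins⇔Holds))))

      Wins-modal-odd : isModal p ≡ true → isOddPos p ≡ true → priority p ≡ m →
                       Wins (suc j) (suc k) p ⇔ All (Wins j K) (moves p)
      Wins-modal-odd modal odd prio = ⇔.trans Wins⇔Holds (⇔.trans (win-modal (suc j) k p modal)
        (⇔.trans (cpre-odd (win j K) p odd prio) (All-cong (λ _ → ⇔.sym Wins⇔Holds))))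

      Wins-modal-even : isModal p ≡ true → isOddPos p ≡ false →
                        Wins (suc j) (suc k) p ⇔ Any (Wins j K) (moves p)
      Wins-modal-even modal even = ⇔.trans Wins⇔Holds (⇔.trans (win-modal (suc j) k p modal)
        (⇔.trans (cpre-even (win j K) p even) (Any-cong (λ _ → ⇔.sym Wins⇔Holds))))

      Wins-terminal : ∀ b → moves p ≡ [] → isModal p ≡ false → isOddPos p ≡ b →
                      priority p ≡ m → Wins j (suc k) p ⇔ T b
      Wins-terminal true none nonmodal odd prio =
        ⇔.trans (Wins-odd nonmodal odd prio) (mk⇔ _ (λ _ → subst (All _) (sym none) []))
      Wins-terminal false none nonmodal even prio =
        ⇔.trans (Wins-even nonmodal even) (mk⇔ (λ w → Any-[] (subst (Any _) none w)) λ ())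
        where
        Any-[] : ∀ {Q : Pos → Set} → ¬ Any Q []
        Any-[] ()

      Wins-step : ∀ {q} → moves p ≡ [ q ] → isModal p ≡ false → isOddPos p ≡ false →
                  Wins j (suc k) p ⇔ Wins j k q
      Wins-step step nonmodal even = ⇔.trans (Wins-even nonmodal even)
        (mk⇔ (Anyₚ.singleton⁻ ∘ subst (Any _) step) (subst (Any _) (sym step) ∘ here))

    Wins-var : ∀ {j k s X φX} → body Ψ X ≡ just φX →
               Wins j (suc k) (s , var X) ⇔ Wins j k (s , φX)
    Wins-var {s = s} {X} {φX} e = Wins-step moves-var refl refl
      where
      moves-var : moves (s , var X) ≡ [ (s , φX) ]
      moves-var rewrite e = refl

    Wins-fix : ∀ {j k s σ X ψ} → Fixpoint σ X ψ → Wins j (suc k) (s , σ) ⇔ Wins j k (s , ψ)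
    Wins-fix μ-fix = Wins-step refl refl refl
    Wins-fix ν-fix = Wins-step refl refl refl

    Wins-∧ : ∀ {j k s φ ψ} → Wins j (suc k) (s , φ ∧ᶠ ψ) ⇔ (Wins j k (s , φ) × Wins j k (s , ψ))
    Wins-∧ = ⇔.trans (Wins-odd refl refl refl)
      (mk⇔ (λ { (a ∷ b ∷ []) → a , b }) (λ (a , b) → a ∷ b ∷ []))

    Wins-∨ : ∀ {j k s φ ψ} → Wins j (suc k) (s , φ ∨ᶠ ψ) ⇔ (Wins j k (s , φ) ⊎ Wins j k (s , ψ))
    Wins-∨ = ⇔.trans (Wins-even refl refl)
      (mk⇔ (λ { (here a) → inj₁ a ; (there (here b)) → inj₂ b })
           (λ { (inj₁ a) → here a ; (inj₂ b) → there (here b) }))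

    Wins-dia : ∀ {j k s ψ} →
               Wins (suc j) (suc k) (s , dia ψ) ⇔ Any (λ t → Wins j K (t , ψ)) (children s)
    Wins-dia = ⇔.trans (Wins-modal-even refl refl) Any-map⇔

    Wins-box : ∀ {j k s ψ} →
               Wins (suc j) (suc k) (s , box ψ) ⇔ All (λ t → Wins j K (t , ψ)) (children s)
    Wins-box = ⇔.trans (Wins-modal-odd refl refl refl) All-map⇔

    Wins-dia-zero : ∀ {k s ψ} → ¬ Wins zero (suc k) (s , dia ψ)
    Wins-dia-zero {k} {s} {ψ} (wins w) = Equivalence.to (win-modal zero k (s , dia ψ) refl) w

    Wins-box-zero : ∀ {k s ψ} → Wins zero (suc k) (s , box ψ)
    Wins-box-zero {k} {s} {ψ} =
      wins (Equivalence.from (win-modal zero k (s , box ψ) refl) (≡⇒≡ᵇ m m refl))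

    module Correctness (r : Tree) where
      open TreeSemantics r

      Agrees : (Tree → Set) → ℕ → Var → Set
      Agrees V j X = ∀ {φX} → body Ψ X ≡ just φX → ∀ s k → rank φX < k →
                     V (trunc j s) ⇔ Wins j k (s , φX)

      -- Before the next modal move only the unguarded variables of φ are looked up at the
      -- current depth j; the others are looked up one modal move later, at depths below j.
      Agreement : (Tree → Set) → ℕ → Var → Formula ℕ → Set
      Agreement V j X φ = (∀ {j'} → j' < j → Agrees V j' X) × (UFree X φ → Agrees V j X)

      EnvAgrees : Env → ℕ → Formula ℕ → Set
      EnvAgrees ρ j φ = ∀ X → Free X φ → Agreement (ρ X) j X φ

      EnvAgrees-sub : ∀ {ρ j φ φ'} → (∀ {X} → Free X φ' → Free X φ) →
                      (∀ {X} → UFree X φ' → UFree X φ) → EnvAgrees ρ j φ → EnvAgrees ρ j φ'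
      EnvAgrees-sub free ufree agr X fr = proj₁ (agr X (free fr)) , proj₂ (agr X (free fr)) ∘ ufree

      EnvAgrees-down : ∀ {ρ j j' φ φ'} → (∀ {X} → Free X φ' → Free X φ) → j' < j →
                       EnvAgrees ρ j φ → EnvAgrees ρ j' φ'
      EnvAgrees-down {ρ} free j'<j agr X fr =
        (λ j''<j' → below (<-trans j''<j' j'<j)) , (λ _ → below j'<j)
        where
        below : ∀ {j''} → j'' < _ → Agrees (ρ X) j'' X
        below = proj₁ (agr X (free fr))

      CorrectAt : ℕ → Formula ℕ → Set₁
      CorrectAt j φ = ∀ ρ → EnvAgrees ρ j φ → ∀ s k → rank φ < k →
                      Sat φ ρ (trunc j s) ⇔ Wins j k (s , φ)

      Correct : ℕ → Set₁
      Correct j = ∀ {φ} → φ ≼ Ψ → CorrectAt j φ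

      -- Guardedness: X is only looked up below depth j, where the induction on j applies to σ.
      correct-fix : ∀ {j σ X ψ} → (∀ {j'} → j' < j → Correct j') → Fixpoint σ X ψ → σ ≼ Ψ →
                    CorrectAt j ψ → ∀ ρ → EnvAgrees ρ j σ → ∀ s k → rank ψ < k →
                    Sat σ ρ (trunc j s) ⇔ Wins j (suc k) (s , σ)
      correct-fix {j} {σ} {X} {ψ} IH fx σ≼Ψ correctψ ρ agr s k lt = begin
        Sat σ ρ (trunc j s)                   ≈⟨ Fixpoint-unfold fx unguarded j ρ (trunc-Depth< j s) ⟩
        Sat ψ (ρ [ X ↦ Sat σ ρ ]) (trunc j s) ≈⟨ correctψ (ρ [ X ↦ Sat σ ρ ]) agr' s k lt ⟩
        Wins j k (s , ψ)                      ≈⟨ Wins-fix fx ⟨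
        Wins j (suc k) (s , σ)                ∎
        where
        open ⇔-Reasoning

        binds : BindsIn X ψ Ψ
        binds = Fixpoint⇒BindsIn fx σ≼Ψ

        unguarded : ¬ UFree X ψ
        unguarded = guarded X ψ binds

        agrees-below : ∀ {j'} → j' < j → Agrees (Sat σ ρ) j' X
        agrees-below {j'} j'<j e s' k' lt' with just-injective (trans (sym (body-binding binds)) e)
        ... | refl = ⇔.trans (IH j'<j σ≼Ψ ρ (EnvAgrees-down {ρ} id j'<j agr) s' (suc k') rank<)
                             (Wins-fix fx)
          where
          rank< : rank σ < suc k'
          rank< = subst (_< suc k') (sym (rankWith-Fixpoint _ fx)) (s≤s lt')

        agr' : EnvAgrees (ρ [ X ↦ Sat σ ρ ]) j ψ
        agr' Y fr with X ≟ Y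
        ... | yes refl = subst (λ V → Agreement V j X ψ) (sym (update-≡ ρ X (Sat σ ρ)))
                               (agrees-below , ⊥-elim ∘ unguarded)
        ... | no X≢Y   = subst (λ V → Agreement V j Y ψ) (sym (update-≢ ρ (Sat σ ρ) X≢Y))
                               (proj₁ agrσ , proj₂ agrσ ∘ Fixpoint-ufree fx (X≢Y ∘ sym))
          where
          agrσ : Agreement (ρ Y) j Y σ
          agrσ = agr Y (Fixpoint-free fx (X≢Y ∘ sym) fr)

      correct-dia : ∀ {j ψ} → (∀ {j'} → j' < j → Correct j') → dia ψ ≼ Ψ →
                    ∀ ρ → EnvAgrees ρ j (dia ψ) → ∀ s k → Sat (dia ψ) ρ (trunc j s) ⇔ Wins j (suc k) (s , dia ψ)
      correct-dia {zero} IH sub ρ agr s k = mk⇔ (λ ()) (⊥-elim ∘ Wins-dia-zero)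
      correct-dia {suc j} {ψ} IH sub ρ agr s k = begin
        Any (Sat ψ ρ) (map (trunc j) (children s))  ≈⟨ Any-map⇔ ⟩
        Any (Sat ψ ρ ∘ trunc j) (children s)         ≈⟨ Any-cong child ⟩
        Any (λ t → Wins j K (t , ψ)) (children s)    ≈⟨ Wins-dia ⟨
        Wins (suc j) (suc k) (s , dia ψ)             ∎
        where
        open ⇔-Reasoning
        ψ≼Ψ : ψ ≼ Ψ
        ψ≼Ψ = ≼-trans (≼-dia ≼-refl) sub
        child : ∀ t → Sat ψ ρ (trunc j t) ⇔ Wins j K (t , ψ)
        child t = IH ≤-refl ψ≼Ψ ρ (EnvAgrees-down {ρ} fr-dia ≤-refl agr) t K (rank<K ψ≼Ψ)

      correct-box : ∀ {j ψ} → (∀ {j'} → j' < j → Correct j') → box ψ ≼ Ψ →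
                    ∀ ρ → EnvAgrees ρ j (box ψ) → ∀ s k → Sat (box ψ) ρ (trunc j s) ⇔ Wins j (suc k) (s , box ψ)
      correct-box {zero} IH sub ρ agr s k = mk⇔ (λ _ → Wins-box-zero) (λ _ → [])
      correct-box {suc j} {ψ} IH sub ρ agr s k = begin
        All (Sat ψ ρ) (map (trunc j) (children s))  ≈⟨ All-map⇔ ⟩
        All (Sat ψ ρ ∘ trunc j) (children s)         ≈⟨ All-cong child ⟩
        All (λ t → Wins j K (t , ψ)) (children s)    ≈⟨ Wins-box ⟨
        Wins (suc j) (suc k) (s , box ψ)             ∎
        where
        open ⇔-Reasoning
        ψ≼Ψ : ψ ≼ Ψ
        ψ≼Ψ = ≼-trans (≼-box ≼-refl) sub
        child : ∀ t → Sat ψ ρ (trunc j t) ⇔ Wins j K (t , ψ)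
        child t = IH ≤-refl ψ≼Ψ ρ (EnvAgrees-down {ρ} fr-box ≤-refl agr) t K (rank<K ψ≼Ψ)

      correctAt : ∀ j → (∀ {j'} → j' < j → Correct j') → ∀ φ → φ ≼ Ψ → CorrectAt j φ
      correctAt j IH φ _ ρ agr s zero ()
      correctAt j IH (prop p)  _ ρ agr s (suc k) _ = ⇔.sym (Wins-terminal _ refl refl refl refl)
      correctAt j IH (nprop p) _ ρ agr s (suc k) _ = ⇔.sym (Wins-terminal _ refl refl refl refl)
      correctAt j IH top       _ ρ agr s (suc k) _ = ⇔.sym (Wins-terminal true refl refl refl refl)
      correctAt j IH bot       _ ρ agr s (suc k) _ = ⇔.sym (Wins-terminal false refl refl refl refl)
      correctAt j IH (var X) sub ρ agr s (suc k) lt with var-body sub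
      ... | φX , e = ⇔.trans (proj₂ (agr X fr-var) uf-var e s k rank<) (⇔.sym (Wins-var e))
        where
        rank< : rank φX < k
        rank< = subst (_≤ k) (rank-var e) (s≤s⁻¹ lt)
      correctAt j IH (φ ∧ᶠ ψ) sub ρ agr s (suc k) lt = ⇔.trans (left ×-⇔ right) (⇔.sym Wins-∧)
        where
        left : Sat φ ρ (trunc j s) ⇔ Wins j k (s , φ)
        left = correctAt j IH φ (≼-trans (≼-∧ˡ ≼-refl) sub) ρ (EnvAgrees-sub {ρ} fr-∧ˡ uf-∧ˡ agr)
                 s k (m⊔n<o⇒m<o _ _ (s≤s⁻¹ lt))
        right : Sat ψ ρ (trunc j s) ⇔ Wins j k (s , ψ)
        right = correctAt j IH ψ (≼-trans (≼-∧ʳ ≼-refl) sub) ρ (EnvAgrees-sub {ρ} fr-∧ʳ uf-∧ʳ agr)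
                  s k (m⊔n<o⇒n<o _ _ (s≤s⁻¹ lt))
      correctAt j IH (φ ∨ᶠ ψ) sub ρ agr s (suc k) lt = ⇔.trans (left ⊎-⇔ right) (⇔.sym Wins-∨)
        where
        left : Sat φ ρ (trunc j s) ⇔ Wins j k (s , φ)
        left = correctAt j IH φ (≼-trans (≼-∨ˡ ≼-refl) sub) ρ (EnvAgrees-sub {ρ} fr-∨ˡ uf-∨ˡ agr)
                 s k (m⊔n<o⇒m<o _ _ (s≤s⁻¹ lt))
        right : Sat ψ ρ (trunc j s) ⇔ Wins j k (s , ψ)
        right = correctAt j IH ψ (≼-trans (≼-∨ʳ ≼-refl) sub) ρ (EnvAgrees-sub {ρ} fr-∨ʳ uf-∨ʳ agr)
                  s k (m⊔n<o⇒n<o _ _ (s≤s⁻¹ lt))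
      correctAt j IH (dia ψ) sub ρ agr s (suc k) _ = correct-dia IH sub ρ agr s k
      correctAt j IH (box ψ) sub ρ agr s (suc k) _ = correct-box IH sub ρ agr s k
      correctAt j IH (mu X ψ) sub ρ agr s (suc k) lt =
        correct-fix IH μ-fix sub (correctAt j IH ψ (≼-trans (≼-mu ≼-refl) sub)) ρ agr s k (s≤s⁻¹ lt)
      correctAt j IH (nu X ψ) sub ρ agr s (suc k) lt =
        correct-fix IH ν-fix sub (correctAt j IH ψ (≼-trans (≼-nu ≼-refl) sub)) ρ agr s k (s≤s⁻¹ lt)

      correct : ∀ j → Correct j
      correct = <-rec Correct (λ j IH → correctAt j IH _)

      Sat-trunc⇔Wins : ∀ j s → Sat Ψ emptyEnv (trunc j s) ⇔ Wins j K (s , Ψ)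
      Sat-trunc⇔Wins j s =
        correct j ≼-refl emptyEnv (λ X free → ⊥-elim (sentence X free)) s K (rank<K ≼-refl)

mainTheorem3 : (Ψ : Formula Var) → Sentence Ψ → Guarded Ψ → WellNamed Ψ → SemModal Ψ →
               (Ωa : PriorityAssignment Ψ) →
               Σ (Formula AProp) λ Φ → FixFree Φ ×
                 ((t : Tree) → treeK t ⊨ Ψ ⇔ (t ×ᵍ Ψ [ Ωa ]) ⊨ Φ)
mainTheorem3 Ψ sentence guarded wellNamed (χ , modal , Ψ⇔χ) Ωa =
  win d K , win-FixFree d K , λ t → begin
    treeK t ⊨ Ψ               ≈⟨ Ψ⇔χ t ⟩
    treeK t ⊨ χ               ≈⟨ Sat-trunc t (trunc d t) χ modal d ≤-refl t ⟩
    treeK (trunc d t) ⊨ χ     ≈⟨ Ψ⇔χ (trunc d t) ⟨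
    treeK (trunc d t) ⊨ Ψ     ≈⟨ Correctness.Sat-trunc⇔Wins t (trunc d t) d t ⟩
    Wins t d K (t , Ψ)        ≈⟨ Wins⇔Holds t ⟩
    (t ×ᵍ Ψ [ Ωa ]) ⊨ win d K ∎
  where
  open Interpretation Ψ sentence guarded wellNamed Ωa
  open WellNamedSentence Ψ sentence guarded wellNamed using (K)
  open Play using (Wins; Wins⇔Holds; module Correctness)
  open ⇔-Reasoning
  d : ℕ
  d = modalDepth χ
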